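{- There is an absolute constant $c>0$ such that the following holds. Let $(M,d)$ be an $n$-point metric space, $\emptyset\subsetneq S\subseteq M$, $x^*\in\mathop{\mathrm{argmin}}_{x\in M}\sum_{y\in M}d(x,y)$, $x^*_S\in\mathop{\mathrm{argmin}}_{x\in S}\sum_{y\in S}d(x,y)$, and $\bar r_S=\frac{1}{|S|^2}\sum_{u,v\in S} d(u,v)$. For all $x'_S\in S$ and $\beta\ge 1$ satisfying $\sum_{y\in S} d(x'_S,y)\le\beta\sum_{y\in S} d(x^*_S,y)$ and $d(x'_S,x^*)> 2\beta\bar r_S$, the point $x'_S$ is a $(c\, n/|S|)$-approximate $1$-median of $(M,d)$, i.e., $$\sum_{y\in M} d(x'_S,y)\le \frac{c\, n}{|S|}\sum_{y\in M} d(x^*,y).$$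
   Context: For $\gamma\ge 1$, a $\gamma$-approximate $1$-median of a finite metric space $(M,d)$ is a point $p\in M$ with $\sum_{y\in M}d(p,y)\le\gamma\min_{q\in M}\sum_{y\in M}d(q,y)$. The paper states the conclusion as "$O(n/|S|)$-approximate", meaning with a constant independent of $(M,d)$, $S$, $\beta$.
   Formalization: The distances of the metric space $(M,d)$ take values in ℚ, and the parameter $\beta$ is rational. -}

module Defs where

open import Data.Nat as ℕ using (ℕ; zero; suc)
open import Data.Integer using (+_)
open import Data.Rational using (ℚ; 0ℚ; _+_; _*_; _/_; _≤_)
open import Data.Fin using (Fin; zero; suc)
open import Data.Fin.Subset using (Subset; ∣_∣)
open import Data.Vec using (lookup)
open import Data.Bool using (Bool; true; false; if_then_else_)
open import Relation.Binary.PropositionalEquality using (_≡_)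
open import Data.Product using (_×_)

record IsMetric (n : ℕ) (d : Fin n → Fin n → ℚ) : Set where
  field
    nonneg   : ∀ x y → 0ℚ ≤ d x y
    zero-iff : ∀ x y → (d x y ≡ 0ℚ → x ≡ y) × (x ≡ y → d x y ≡ 0ℚ)
    sym      : ∀ x y → d x y ≡ d y x
    triangle : ∀ x y z → d x z ≤ d x y + d y z

sumAll : ∀ {n} → (Fin n → ℚ) → ℚ
sumAll {zero}  f = 0ℚ
sumAll {suc n} f = f zero + sumAll (λ i → f (suc i))

sumOver : ∀ {n} → Subset n → (Fin n → ℚ) → ℚ
sumOver S f = sumAll (λ i → if lookup S i then f i else 0ℚ)

cost : ∀ {n} → (Fin n → Fin n → ℚ) → Fin n → ℚ
cost d x = sumAll (d x)

costS : ∀ {n} → (Fin n → Fin n → ℚ) → Subset n → Fin n → ℚ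
costS d S x = sumOver S (d x)

-- a / b as a rational (convention: 0 when b = 0; only used with b ≠ 0)
ratio : ℕ → ℕ → ℚ
ratio a zero    = 0ℚ
ratio a (suc b) = (+ a) / suc b

rbar : ∀ {n} → (Fin n → Fin n → ℚ) → Subset n → ℚ
rbar d S = ratio 1 (∣ S ∣ ℕ.* ∣ S ∣) * sumOver S (λ u → sumOver S (d u))

{-# OPTIONS --safe #-}
module Submission where

-- Let k = |S| and D = d(x', x*). The optimal S-cost is at most the average S-cost k r̄_S, so
-- cost_S(x') ≤ β k r̄_S < k D / 2. Summing d(x', x*) ≤ d(x*, y) + d(x', y) over y ∈ S gives
-- k D ≤ cost(x*) + cost_S(x') < cost(x*) + k D / 2, i.e. k D ≤ 2 cost(x*). Summing
-- d(x', y) ≤ D + d(x*, y) over all y then gives cost(x') ≤ n D + cost(x*) ≤ 3 (n / k) cost(x*).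

open import Defs
open import Algebra.Bundles using (CommutativeMonoid; CommutativeRing)
open import Data.Fin using (Fin; zero; suc)
open import Data.Fin.Subset using (Subset; Nonempty; _∈_; ∣_∣; ⊤; inside; outside)
open import Data.Fin.Subset.Properties using (∣p∣≤n; ∣⊤∣≡n)
open import Data.Integer as ℤ using (+_)
open import Data.Integer.Tactic.RingSolver using (solve-∀)
open import Data.Nat as ℕ using (ℕ; zero; suc; NonZero; z≤n; s≤s)
import Data.Nat.Properties as ℕ
open import Data.Product using (∃-syntax; _×_; _,_)
open import Data.Rational
  using (ℚ; 0ℚ; 1ℚ; _+_; _*_; -_; _≤_; _<_; NonNegative; Positive; nonNegative; positive; toℚᵘ)
import Data.Rational.Properties as ℚ
open import Data.Rational.Solver using (module +-*-Solver)
open import Data.Rational.Unnormalised as ℚᵘ using (mkℚᵘ; *≡*; _≃_)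
import Data.Rational.Unnormalised.Properties as ℚᵘ
open import Data.Vec using ([]; _∷_; here; there)
open import Relation.Binary.PropositionalEquality using (_≡_; refl; sym; trans; cong; cong₂; subst; module ≡-Reasoning)
open import Algebra.Properties.CommutativeSemigroup (CommutativeMonoid.commutativeSemigroup ℚ.+-0-commutativeMonoid)
  using () renaming (interchange to +-interchange)
open import Algebra.Properties.Semiring.Mult (CommutativeRing.semiring ℚ.+-*-commutativeRing)
  using () renaming (_×_ to _×ℚ_; ×1-homo-* to ι-*)

open +-*-Solver

ι : ℕ → ℚ
ι n = n ×ℚ 1ℚ

0≤ι : ∀ n → 0ℚ ≤ ι n
0≤ι zero    = ℚ.≤-refl
0≤ι (suc n) = ℚ.+-mono-≤ (ℚ.nonNegative⁻¹ 1ℚ) (0≤ι n)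

ι-nonNeg : ∀ n → NonNegative (ι n)
ι-nonNeg n = nonNegative (0≤ι n)

ι-pos : ∀ n .{{_ : NonZero n}} → Positive (ι n)
ι-pos (suc n) = positive (ℚ.+-mono-<-≤ (ℚ.positive⁻¹ 1ℚ) (0≤ι n))

ι-mono-≤ : ∀ {m n} → m ℕ.≤ n → ι m ≤ ι n
ι-mono-≤ {n = n} z≤n = 0≤ι n
ι-mono-≤ (s≤s m≤n)   = ℚ.+-monoʳ-≤ 1ℚ (ι-mono-≤ m≤n)

toℚᵘ-ι : ∀ n → toℚᵘ (ι n) ≃ mkℚᵘ (+ n) 0
toℚᵘ-ι zero    = *≡* refl
toℚᵘ-ι (suc n) = begin-equality
  toℚᵘ (1ℚ + ι n)                    ≃⟨ ℚ.toℚᵘ-homo-+ 1ℚ (ι n) ⟩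
  toℚᵘ 1ℚ ℚᵘ.+ toℚᵘ (ι n)           ≃⟨ ℚᵘ.+-congʳ (toℚᵘ 1ℚ) (toℚᵘ-ι n) ⟩
  mkℚᵘ (+ 1) 0 ℚᵘ.+ mkℚᵘ (+ n) 0    ≃⟨ *≡* (cross-multiplied (+ n)) ⟩
  mkℚᵘ (+ suc n) 0                   ∎
  where
  open ℚᵘ.≤-Reasoning
  cross-multiplied : ∀ i → (+ 1 ℤ.* + 1 ℤ.+ i ℤ.* + 1) ℤ.* + 1 ≡ (+ 1 ℤ.+ i) ℤ.* (+ 1 ℤ.* + 1)
  cross-multiplied = solve-∀

ι-*-ratio : ∀ a n .{{_ : NonZero n}} → ι n * ratio a n ≡ ι a
ι-*-ratio a (suc n) = ℚ.toℚᵘ-injective (begin-equality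
  toℚᵘ (ι (suc n) * ratio a (suc n))                 ≃⟨ ℚ.toℚᵘ-homo-* (ι (suc n)) (ratio a (suc n)) ⟩
  toℚᵘ (ι (suc n)) ℚᵘ.* toℚᵘ (ratio a (suc n))      ≃⟨ ℚᵘ.*-cong (toℚᵘ-ι (suc n)) (ℚ.toℚᵘ-fromℚᵘ (mkℚᵘ (+ a) n)) ⟩
  mkℚᵘ (+ suc n) 0 ℚᵘ.* mkℚᵘ (+ a) n               ≃⟨ *≡* (cross-multiplied (+ suc n) (+ a)) ⟩
  mkℚᵘ (+ a) 0                                       ≃⟨ toℚᵘ-ι a ⟨
  toℚᵘ (ι a)                                         ∎)
  where
  open ℚᵘ.≤-Reasoning
  cross-multiplied : ∀ i j → (i ℤ.* j) ℤ.* + 1 ≡ j ℤ.* (+ 1 ℤ.* i)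
  cross-multiplied = solve-∀

sumOver-mono-≤ : ∀ {n} (S : Subset n) {f g : Fin n → ℚ} →
                 (∀ i → i ∈ S → f i ≤ g i) → sumOver S f ≤ sumOver S g
sumOver-mono-≤ []            f≤g = ℚ.≤-refl
sumOver-mono-≤ (inside  ∷ S) f≤g = ℚ.+-mono-≤ (f≤g zero here) (sumOver-mono-≤ S (λ i i∈S → f≤g (suc i) (there i∈S)))
sumOver-mono-≤ (outside ∷ S) f≤g = ℚ.+-monoʳ-≤ 0ℚ (sumOver-mono-≤ S (λ i i∈S → f≤g (suc i) (there i∈S)))

sumOver-nonNeg : ∀ {n} (S : Subset n) {f : Fin n → ℚ} → (∀ i → 0ℚ ≤ f i) → 0ℚ ≤ sumOver S f
sumOver-nonNeg []            0≤f = ℚ.≤-refl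
sumOver-nonNeg (inside  ∷ S) 0≤f = ℚ.+-mono-≤ (0≤f zero) (sumOver-nonNeg S (λ i → 0≤f (suc i)))
sumOver-nonNeg (outside ∷ S) 0≤f = ℚ.+-monoʳ-≤ 0ℚ (sumOver-nonNeg S (λ i → 0≤f (suc i)))

sumOver-≤-sumAll : ∀ {n} (S : Subset n) {f : Fin n → ℚ} → (∀ i → 0ℚ ≤ f i) → sumOver S f ≤ sumAll f
sumOver-≤-sumAll []                0≤f = ℚ.≤-refl
sumOver-≤-sumAll (inside  ∷ S) {f} 0≤f = ℚ.+-monoʳ-≤ (f zero) (sumOver-≤-sumAll S (λ i → 0≤f (suc i)))
sumOver-≤-sumAll (outside ∷ S)     0≤f = ℚ.+-mono-≤ (0≤f zero) (sumOver-≤-sumAll S (λ i → 0≤f (suc i)))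

sumOver-+ : ∀ {n} (S : Subset n) (f g : Fin n → ℚ) →
            sumOver S (λ i → f i + g i) ≡ sumOver S f + sumOver S g
sumOver-+ []            f g = refl
sumOver-+ (inside  ∷ S) f g =
  trans (cong (_+_ (f zero + g zero)) (sumOver-+ S f′ g′)) (+-interchange (f zero) (g zero) (sumOver S f′) (sumOver S g′))
  where f′ = λ i → f (suc i); g′ = λ i → g (suc i)
sumOver-+ (outside ∷ S) f g = -- 0ℚ + 0ℚ computes to 0ℚ
  trans (cong (_+_ 0ℚ) (sumOver-+ S f′ g′)) (+-interchange 0ℚ 0ℚ (sumOver S f′) (sumOver S g′))
  where f′ = λ i → f (suc i); g′ = λ i → g (suc i)

sumOver-const : ∀ {n} (S : Subset n) (c : ℚ) → sumOver S (λ _ → c) ≡ ι ∣ S ∣ * c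
sumOver-const []            c = sym (ℚ.*-zeroˡ c)
sumOver-const (inside  ∷ S) c = begin
  c + sumOver S (λ _ → c)  ≡⟨ cong (_+_ c) (sumOver-const S c) ⟩
  c + ι ∣ S ∣ * c          ≡⟨ solve 2 (λ k c → c :+ k :* c := (con 1ℚ :+ k) :* c) refl (ι ∣ S ∣) c ⟩
  (1ℚ + ι ∣ S ∣) * c       ∎
  where open ≡-Reasoning
sumOver-const (outside ∷ S) c = begin
  0ℚ + sumOver S (λ _ → c) ≡⟨ ℚ.+-identityˡ _ ⟩
  sumOver S (λ _ → c)      ≡⟨ sumOver-const S c ⟩
  ι ∣ S ∣ * c              ∎
  where open ≡-Reasoning

sumAll≡sumOver⊤ : ∀ {n} (f : Fin n → ℚ) → sumAll f ≡ sumOver ⊤ f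
sumAll≡sumOver⊤ {zero}  f = refl
sumAll≡sumOver⊤ {suc n} f = cong (_+_ (f zero)) (sumAll≡sumOver⊤ (λ i → f (suc i)))

∈⇒∣p∣-nonZero : ∀ {n} {x : Fin n} {p : Subset n} → x ∈ p → NonZero ∣ p ∣
∈⇒∣p∣-nonZero here                        = _
∈⇒∣p∣-nonZero (there {y = inside}  x∈p) = _
∈⇒∣p∣-nonZero (there {y = outside} x∈p) = ∈⇒∣p∣-nonZero x∈p

+-cancelʳ-≤ : ∀ {x y} z → x + z ≤ y + z → x ≤ y
+-cancelʳ-≤ {x} {y} z x+z≤y+z = begin
  x                ≡⟨ solve 2 (λ x z → x := (x :+ z) :+ (:- z)) refl x z ⟩
  (x + z) + (- z)  ≤⟨ ℚ.+-monoˡ-≤ (- z) x+z≤y+z ⟩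
  (y + z) + (- z)  ≡⟨ solve 2 (λ y z → (y :+ z) :+ (:- z) := y) refl y z ⟩
  y                ∎
  where open ℚ.≤-Reasoning

p≤q+r∧2r≤p⇒p≤2q : ∀ {p} q r → p ≤ q + r → (1ℚ + 1ℚ) * r ≤ p → p ≤ (1ℚ + 1ℚ) * q
p≤q+r∧2r≤p⇒p≤2q {p} q r p≤q+r 2r≤p = +-cancelʳ-≤ p (begin
  p + p                          ≤⟨ ℚ.+-mono-≤ p≤q+r p≤q+r ⟩
  (q + r) + (q + r)              ≡⟨ solve 2 (λ q r → (q :+ r) :+ (q :+ r) := two :* q :+ two :* r) refl q r ⟩
  (1ℚ + 1ℚ) * q + (1ℚ + 1ℚ) * r  ≤⟨ ℚ.+-monoʳ-≤ ((1ℚ + 1ℚ) * q) 2r≤p ⟩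
  (1ℚ + 1ℚ) * q + p              ∎)
  where
  open ℚ.≤-Reasoning
  two = con 1ℚ :+ con 1ℚ

kb≤2c∧a≤nb+c⇒a≤3[n/k]c : ∀ {k n} .{{_ : NonZero k}} {a b c : ℚ} → k ℕ.≤ n → 0ℚ ≤ c →
                          ι k * b ≤ (1ℚ + 1ℚ) * c → a ≤ ι n * b + c → a ≤ ι 3 * ratio n k * c
kb≤2c∧a≤nb+c⇒a≤3[n/k]c {k} {n} {a} {b} {c} k≤n 0≤c kb≤2c a≤nb+c =
  ℚ.*-cancelˡ-≤-pos (ι k) {{ι-pos k}} (begin
    ι k * a                          ≤⟨ ℚ.*-monoˡ-≤-nonNeg (ι k) {{ι-nonNeg k}} a≤nb+c ⟩
    ι k * (ι n * b + c)              ≡⟨ solve 4 (λ k n b c → k :* (n :* b :+ c) := n :* (k :* b) :+ k :* c) refl (ι k) (ι n) b c ⟩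
    ι n * (ι k * b) + ι k * c        ≤⟨ ℚ.+-mono-≤ (ℚ.*-monoˡ-≤-nonNeg (ι n) {{ι-nonNeg n}} kb≤2c)
                                                   (ℚ.*-monoʳ-≤-nonNeg c {{nonNegative 0≤c}} (ι-mono-≤ k≤n)) ⟩
    ι n * ((1ℚ + 1ℚ) * c) + ι n * c  ≡⟨ solve 2 (λ n c → n :* (two :* c) :+ n :* c := con (ι 3) :* n :* c) refl (ι n) c ⟩
    ι 3 * ι n * c                    ≡⟨ cong (λ t → ι 3 * t * c) (ι-*-ratio n k) ⟨
    ι 3 * (ι k * ratio n k) * c      ≡⟨ solve 4 (λ t k r c → t :* (k :* r) :* c := k :* (t :* r :* c)) refl (ι 3) (ι k) (ratio n k) c ⟩
    ι k * (ι 3 * ratio n k * c)      ∎)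
  where
  open ℚ.≤-Reasoning
  two = con 1ℚ :+ con 1ℚ

module _ {n} (d : Fin n → Fin n → ℚ) (S : Subset n) .{{_ : NonZero ∣ S ∣}} where

  sumOver-costS≡∣S∣²*rbar : sumOver S (costS d S) ≡ ι ∣ S ∣ * (ι ∣ S ∣ * rbar d S)
  sumOver-costS≡∣S∣²*rbar = sym (begin
    ι k * (ι k * (ratio 1 (k ℕ.* k) * T))  ≡⟨ solve 4 (λ a b r t → a :* (b :* (r :* t)) := a :* b :* r :* t) refl (ι k) (ι k) (ratio 1 (k ℕ.* k)) T ⟩
    ι k * ι k * ratio 1 (k ℕ.* k) * T      ≡⟨ cong (λ t → t * ratio 1 (k ℕ.* k) * T) (ι-* k k) ⟨
    ι (k ℕ.* k) * ratio 1 (k ℕ.* k) * T    ≡⟨ cong (_* T) (ι-*-ratio 1 (k ℕ.* k) {{ℕ.m*n≢0 k k}}) ⟩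
    1ℚ * T                                 ≡⟨ ℚ.*-identityˡ T ⟩
    T                                      ∎)
    where
    open ≡-Reasoning
    k = ∣ S ∣
    T = sumOver S (costS d S)

  costS-min≤∣S∣*rbar : ∀ {m} → (∀ x → x ∈ S → costS d S m ≤ costS d S x) → costS d S m ≤ ι ∣ S ∣ * rbar d S
  costS-min≤∣S∣*rbar {m} m-min = ℚ.*-cancelˡ-≤-pos (ι ∣ S ∣) {{ι-pos ∣ S ∣}} (begin
    ι ∣ S ∣ * costS d S m             ≡⟨ sumOver-const S (costS d S m) ⟨
    sumOver S (λ _ → costS d S m)     ≤⟨ sumOver-mono-≤ S m-min ⟩
    sumOver S (costS d S)             ≡⟨ sumOver-costS≡∣S∣²*rbar ⟩
    ι ∣ S ∣ * (ι ∣ S ∣ * rbar d S)    ∎)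
    where open ℚ.≤-Reasoning

module _ {n} {d : Fin n → Fin n → ℚ} (metric : IsMetric n d) where
  open IsMetric metric renaming (sym to d-sym)
  open ℚ.≤-Reasoning

  ∣S∣*dist≤costS+costS : ∀ S x z → ι ∣ S ∣ * d x z ≤ costS d S x + costS d S z
  ∣S∣*dist≤costS+costS S x z = begin
    ι ∣ S ∣ * d x z                  ≡⟨ sumOver-const S (d x z) ⟨
    sumOver S (λ _ → d x z)          ≤⟨ sumOver-mono-≤ S (λ y _ → triangle-via y) ⟩
    sumOver S (λ y → d x y + d z y)  ≡⟨ sumOver-+ S (d x) (d z) ⟩
    costS d S x + costS d S z        ∎
    where
    triangle-via : ∀ y → d x z ≤ d x y + d z y
    triangle-via y = subst (λ t → d x z ≤ d x y + t) (d-sym y z) (triangle x y z)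

  costS≤∣S∣*dist+costS : ∀ S x z → costS d S x ≤ ι ∣ S ∣ * d x z + costS d S z
  costS≤∣S∣*dist+costS S x z = begin
    costS d S x                            ≤⟨ sumOver-mono-≤ S (λ y _ → triangle x z y) ⟩
    sumOver S (λ y → d x z + d z y)        ≡⟨ sumOver-+ S (λ _ → d x z) (d z) ⟩
    sumOver S (λ _ → d x z) + costS d S z  ≡⟨ cong (_+ costS d S z) (sumOver-const S (d x z)) ⟩
    ι ∣ S ∣ * d x z + costS d S z          ∎

  cost≤n*dist+cost : ∀ x z → cost d x ≤ ι n * d x z + cost d z
  cost≤n*dist+cost x z = begin
    cost d x                        ≡⟨ sumAll≡sumOver⊤ (d x) ⟩
    costS d ⊤ x                     ≤⟨ costS≤∣S∣*dist+costS (⊤ {n}) x z ⟩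
    ι ∣ ⊤ {n} ∣ * d x z + costS d ⊤ z   ≡⟨ cong₂ (λ k c → ι k * d x z + c) (∣⊤∣≡n n) (sym (sumAll≡sumOver⊤ (d z))) ⟩
    ι n * d x z + cost d z          ∎

  0≤cost : ∀ x → 0ℚ ≤ cost d x
  0≤cost x = subst (0ℚ ≤_) (sym (sumAll≡sumOver⊤ (d x))) (sumOver-nonNeg (⊤ {n}) (nonneg x))

  costS≤cost : ∀ S x → costS d S x ≤ cost d x
  costS≤cost S x = sumOver-≤-sumAll S (nonneg x)

  far⇒∣S∣*dist≤2*cost : ∀ S .{{_ : NonZero ∣ S ∣}} {m x z : Fin n} {β : ℚ} → 0ℚ ≤ β →
                         (∀ y → y ∈ S → costS d S m ≤ costS d S y) → costS d S x ≤ β * costS d S m →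
                         (1ℚ + 1ℚ) * β * rbar d S < d x z → ι ∣ S ∣ * d x z ≤ (1ℚ + 1ℚ) * cost d z
  far⇒∣S∣*dist≤2*cost S {m} {x} {z} {β} 0≤β m-min x-approx far =
    p≤q+r∧2r≤p⇒p≤2q (cost d z) (costS d S x) ∣S∣*dist≤cost+costS 2*costS≤∣S∣*dist
    where
    k = ∣ S ∣
    r = rbar d S

    costS≤∣S∣*β*rbar : costS d S x ≤ ι k * (β * r)
    costS≤∣S∣*β*rbar = begin
      costS d S x        ≤⟨ x-approx ⟩
      β * costS d S m    ≤⟨ ℚ.*-monoˡ-≤-nonNeg β {{nonNegative 0≤β}} (costS-min≤∣S∣*rbar d S m-min) ⟩
      β * (ι k * r)      ≡⟨ solve 3 (λ b k r → b :* (k :* r) := k :* (b :* r)) refl β (ι k) r ⟩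
      ι k * (β * r)      ∎

    2*costS≤∣S∣*dist : (1ℚ + 1ℚ) * costS d S x ≤ ι k * d x z
    2*costS≤∣S∣*dist = begin
      (1ℚ + 1ℚ) * costS d S x      ≤⟨ ℚ.*-monoˡ-≤-nonNeg (1ℚ + 1ℚ) costS≤∣S∣*β*rbar ⟩
      (1ℚ + 1ℚ) * (ι k * (β * r))  ≡⟨ solve 3 (λ k b r → two :* (k :* (b :* r)) := k :* (two :* b :* r)) refl (ι k) β r ⟩
      ι k * ((1ℚ + 1ℚ) * β * r)    ≤⟨ ℚ.*-monoˡ-≤-nonNeg (ι k) {{ι-nonNeg k}} (ℚ.<⇒≤ far) ⟩
      ι k * d x z                  ∎
      where two = con 1ℚ :+ con 1ℚ

    ∣S∣*dist≤cost+costS : ι k * d x z ≤ cost d z + costS d S x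
    ∣S∣*dist≤cost+costS = begin
      ι k * d x z                ≡⟨ cong (ι k *_) (d-sym x z) ⟩
      ι k * d z x                ≤⟨ ∣S∣*dist≤costS+costS S z x ⟩
      costS d S z + costS d S x  ≤⟨ ℚ.+-monoˡ-≤ (costS d S x) (costS≤cost S z) ⟩
      cost d z + costS d S x     ∎

lemma4 : ∃[ c ] (0ℚ < c × (∀ (n : ℕ) (d : Fin n → Fin n → ℚ) → IsMetric n d → (S : Subset n) → Nonempty S → (xstar : Fin n) → (∀ x → cost d xstar ≤ cost d x) → (xstarS : Fin n) → xstarS ∈ S → (∀ x → x ∈ S → costS d S xstarS ≤ costS d S x) → (x' : Fin n) → x' ∈ S → (β : ℚ) → 1ℚ ≤ β → costS d S x' ≤ β * costS d S xstarS → (1ℚ + 1ℚ) * β * rbar d S < d x' xstar → cost d x' ≤ c * ratio n ∣ S ∣ * cost d xstar))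
lemma4 = ι 3 , ℚ.positive⁻¹ (ι 3) {{ι-pos 3}} ,
  λ n d metric S _ x* _ x*ₛ _ x*ₛ-min x x∈S β 1≤β x-approx far →
    let ∣S∣≢0 = ∈⇒∣p∣-nonZero x∈S
        0≤β = ℚ.≤-trans (ℚ.nonNegative⁻¹ 1ℚ) 1≤β
    in kb≤2c∧a≤nb+c⇒a≤3[n/k]c {{∣S∣≢0}} (∣p∣≤n S) (0≤cost metric x*)
         (far⇒∣S∣*dist≤2*cost metric S {{∣S∣≢0}} 0≤β x*ₛ-min x-approx far)
         (cost≤n*dist+cost metric x x*)
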